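{- Let $S$ be a solid and let $x\in S$ with $x\ne e(x)$, and suppose $x=a+e(x)$ with $e(a)=0$. Then (1) $e(x)<|a|$; (2) $e(x)a^{ -1}=e(x)x^{ -1}=e(u(x))$.
   Context: A solid is a set $S$ with binary operations $+$ and $\cdot$ and a relation $\le$ satisfying: (1) $+$ is associative and commutative; for every $x$ there is a unique $e$ with $x+e=x$ and $e+f=e$ whenever $x+f=x$, written $e(x)$ (the magnitude of $x$); for every $x$ there is $s$ with $x+s=e(x)$ and $e(s)=e(x)$, written $-x$; $e(x+y)=e(x)$ or $e(x+y)=e(y)$. (2) $\cdot$ is associative and commutative; for every $x\ne e(x)$ there is a unique $u$ with $xu=x$ and $uv=u$ whenever $xv=x$, written $u(x)$; for every $x\ne e(x)$ there is $d$ with $xd=u(x)$ and $u(d)=u(x)$, written $x^{ -1}$; for $x\ne e(x),y\ne e(y)$: $u(xy)=u(x)$ or $u(xy)=u(y)$. (3) $\le$ is a total order; $x\le y\Rightarrow x+z\le y+z$; $y+e(x)=e(x)\Rightarrow (y\le e(x)$ and $-y\le e(x))$; $(e(x)<x$ and $y\le z)\Rightarrow xy\le xz$; $e(y)\le y\le z\Rightarrow e(x)y\le e(x)z$. (4) For all $x,y$ there is $z$ with $e(x)y=e(z)$; $e(xy)=e(x)y+e(y)x$; for $x\ne e(x)$, $e(u(x))=e(x)x^{ -1}$; $xy+xz=x(y+z)+e(x)y+e(x)z$; $-(xy)=(-x)y$. (5) There is $0$ with $0+x=x$ for all $x$; there is $1$ with $1x=x$ for all $x$; there is $M$ with $e(x)+M=M$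 for all $x$; there is $x$ with $e(x)\ne 0$ and $e(x)\ne M$; for every $x$ there is $a$ with $x=a+e(x)$ and $e(a)=0$; if $x=e(x)$, $y=e(y)$ and $x<y$ then there is $z\ne e(z)$ with $x<z<y$. The absolute value is $|x|=x$ if $e(x)\le x$ and $|x|=-x$ if $x<e(x)$. -}

module Defs where

open import Level using (Level; suc; _⊔_)
open import Data.Product using (Σ; ∃; _×_; _,_)
open import Data.Sum using (_⊎_)
open import Relation.Nullary using (¬_)
open import Relation.Binary.PropositionalEquality using (_≡_; _≢_)
open import Relation.Binary.Structures using (IsTotalOrder)

-- The notations e(x), -x, u(x), x⁻¹ are given as functions whose
-- defining properties are fields.  u and _⁻¹ are total functions whose
-- specification is only imposed when x ≢ e x (their values at x = e x
-- are irrelevant/unconstrained).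
record Solid (c ℓ : Level) : Set (suc (c ⊔ ℓ)) where
  infixl 6 _+_
  infixl 7 _·_
  infix 4 _≤_ _<_
  field
    Carrier : Set c
    _+_ : Carrier → Carrier → Carrier
    _·_ : Carrier → Carrier → Carrier
    _≤_ : Carrier → Carrier → Set ℓ
    e   : Carrier → Carrier
    -_  : Carrier → Carrier
    u   : Carrier → Carrier
    _⁻¹ : Carrier → Carrier

  _<_ : Carrier → Carrier → Set (c ⊔ ℓ)
  x < y = x ≤ y × x ≢ y

  field
    +-assoc : ∀ x y z → (x + y) + z ≡ x + (y + z)
    +-comm  : ∀ x y → x + y ≡ y + x
    e-neutral : ∀ x → x + e x ≡ x
    e-least   : ∀ x f → x + f ≡ x → e x + f ≡ e x
    e-unique  : ∀ x e′ → x + e′ ≡ x → (∀ f → x + f ≡ x → e′ + f ≡ e′) → e′ ≡ e x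
    neg-inv   : ∀ x → x + (- x) ≡ e x
    neg-e     : ∀ x → e (- x) ≡ e x
    e-+       : ∀ x y → e (x + y) ≡ e x ⊎ e (x + y) ≡ e y
    ·-assoc : ∀ x y z → (x · y) · z ≡ x · (y · z)
    ·-comm  : ∀ x y → x · y ≡ y · x
    u-neutral : ∀ x → x ≢ e x → x · u x ≡ x
    u-least   : ∀ x → x ≢ e x → ∀ v → x · v ≡ x → u x · v ≡ u x
    u-unique  : ∀ x → x ≢ e x → ∀ u′ → x · u′ ≡ x → (∀ v → x · v ≡ x → u′ · v ≡ u′) → u′ ≡ u x
    inv-inv   : ∀ x → x ≢ e x → x · (x ⁻¹) ≡ u x
    inv-u     : ∀ x → x ≢ e x → u (x ⁻¹) ≡ u x
    u-·       : ∀ x y → x ≢ e x → y ≢ e y → u (x · y) ≡ u x ⊎ u (x · y) ≡ u y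
    isTotalOrder : IsTotalOrder _≡_ _≤_
    ≤-+       : ∀ x y z → x ≤ y → x + z ≤ y + z
    ≤-e       : ∀ x y → y + e x ≡ e x → (y ≤ e x × - y ≤ e x)
    ≤-·       : ∀ x y z → e x < x → y ≤ z → x · y ≤ x · z
    ≤-e·      : ∀ x y z → e y ≤ y → y ≤ z → e x · y ≤ e x · z
    e·-is-e   : ∀ x y → ∃ λ z → e x · y ≡ e z
    e-·       : ∀ x y → e (x · y) ≡ e x · y + e y · x
    e-u       : ∀ x → x ≢ e x → e (u x) ≡ e x · (x ⁻¹)
    distrib   : ∀ x y z → x · y + x · z ≡ x · (y + z) + e x · y + e x · z
    neg-·     : ∀ x y → - (x · y) ≡ (- x) · y
    zero : Carrier
    zero-id : ∀ x → zero + x ≡ x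
    one : Carrier
    one-id : ∀ x → one · x ≡ x
    M : Carrier
    M-absorb : ∀ x → e x + M ≡ M
    nontrivial : ∃ λ x → e x ≢ zero × e x ≢ M
    decomp : ∀ x → ∃ λ a → x ≡ a + e x × e a ≡ zero
    dense : ∀ x y → x ≡ e x → y ≡ e y → x < y →
            ∃ λ z → z ≢ e z × x < z × z < y

  -- "c < |x|", unfolding |x| = x if e(x) ≤ x and |x| = -x if x < e(x).
  _<∣_∣ : Carrier → Carrier → Set (c ⊔ ℓ)
  c <∣ x ∣ = (e x ≤ x → c < x) × (x < e x → c < - x)

module Submission where

open import Defs
open import Level using (Level)
open import Data.Product using (_×_; _,_; proj₁; proj₂)
open import Data.Sum using (inj₁; inj₂)
open import Data.Empty using (⊥-elim)
open import Relation.Nullary using (¬_)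
open import Relation.Binary.PropositionalEquality
open import Relation.Binary.Structures using (IsTotalOrder)

-- (1): if |a| ≤ e(x) then a, or a together with -a, is absorbed by the
-- magnitude e(x), forcing x = a + e(x) = e(x).
-- (2): put F = e(u(x)) = e(x) x⁻¹, a magnitude with F x = e(x).  Monotonicity
-- of multiplication by F squeezes F a between F e(x) and F x = e(x); then
-- distributivity gives F a = e(x) + F a, i.e. e(x) ≤ F a, so F a = e(x).
-- Multiplying by a⁻¹ turns this into e(x) a⁻¹ = F u(a) = e(x) x⁻¹.

module SolidProperties {c ℓ : Level} (S : Solid c ℓ) where
  open Solid S
  open IsTotalOrder isTotalOrder using (total; antisym; reflexive)
  open ≡-Reasoning

  Magnitude : Carrier → Set c
  Magnitude m = e m ≡ m

  ≰⇒> : ∀ {b c} → ¬ b ≤ c → c < b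
  ≰⇒> {b} {c} b≰c with total c b
  ... | inj₁ c≤b = c≤b , λ c≡b → b≰c (reflexive (sym c≡b))
  ... | inj₂ b≤c = ⊥-elim (b≰c b≤c)

  idempotent⇒magnitude : ∀ {m} → m + m ≡ m → Magnitude m
  idempotent⇒magnitude {m} m+m≡m = sym (e-unique m m m+m≡m (λ _ m+f≡m → m+f≡m))

  magnitude⇒idempotent : ∀ {m} → Magnitude m → m + m ≡ m
  magnitude⇒idempotent {m} em≡m = subst (λ t → m + t ≡ m) em≡m (e-neutral m)

  e-magnitude : ∀ y → Magnitude (e y)
  e-magnitude y = idempotent⇒magnitude (e-least y (e y) (e-neutral y))

  e·-magnitude : ∀ y z → Magnitude (e y · z)
  e·-magnitude y z = let (w , ey·z≡ew) = e·-is-e y z in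
    subst Magnitude (sym ey·z≡ew) (e-magnitude w)

  +-idempotent : ∀ {m n} → m + m ≡ m → n + n ≡ n → (m + n) + (m + n) ≡ m + n
  +-idempotent {m} {n} m+m≡m n+n≡n = begin
    (m + n) + (m + n) ≡⟨ +-assoc m n (m + n) ⟩
    m + (n + (m + n)) ≡⟨ cong (m +_) (sym (+-assoc n m n)) ⟩
    m + ((n + m) + n) ≡⟨ cong (λ t → m + (t + n)) (+-comm n m) ⟩
    m + ((m + n) + n) ≡⟨ cong (m +_) (+-assoc m n n) ⟩
    m + (m + (n + n)) ≡⟨ cong (λ t → m + (m + t)) n+n≡n ⟩
    m + (m + n)       ≡⟨ sym (+-assoc m m n) ⟩
    (m + m) + n       ≡⟨ cong (_+ n) m+m≡m ⟩
    m + n             ∎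

  magnitude-+ : ∀ {m n} → Magnitude m → Magnitude n → Magnitude (m + n)
  magnitude-+ em≡m en≡n =
    idempotent⇒magnitude (+-idempotent (magnitude⇒idempotent em≡m) (magnitude⇒idempotent en≡n))

  absorbs⇒≤ : ∀ {m n} → Magnitude n → m + n ≡ n → m ≤ n
  absorbs⇒≤ {m} {n} en≡n m+n≡n =
    subst (m ≤_) en≡n (proj₁ (≤-e n m (subst (λ t → m + t ≡ t) (sym en≡n) m+n≡n)))

  ≤⇒absorbs : ∀ {m n} → Magnitude m → Magnitude n → m ≤ n → m + n ≡ n
  ≤⇒absorbs {m} {n} em≡m en≡n m≤n with e-+ m n
  ... | inj₂ e[m+n]≡en = trans (sym (magnitude-+ em≡m en≡n)) (trans e[m+n]≡en en≡n)
  ... | inj₁ e[m+n]≡em = trans m+n≡m (antisym m≤n n≤m)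
    where
    m+n≡m : m + n ≡ m
    m+n≡m = trans (sym (magnitude-+ em≡m en≡n)) (trans e[m+n]≡em em≡m)
    n≤m : n ≤ m
    n≤m = absorbs⇒≤ em≡m (trans (+-comm n m) m+n≡m)

  absorbed-by-magnitude : ∀ {m b} → Magnitude m → zero ≤ b → b ≤ m → b + m ≡ m
  absorbed-by-magnitude {m} {b} em≡m 0≤b b≤m = antisym
    (subst (b + m ≤_) (magnitude⇒idempotent em≡m) (≤-+ b m m b≤m))
    (subst (_≤ b + m) (zero-id m) (≤-+ zero b m 0≤b))

  zero≤e : ∀ y → zero ≤ e y
  zero≤e y = proj₁ (≤-e y zero (zero-id (e y)))

  nonpositive⇒neg-nonnegative : ∀ {a} → e a ≡ zero → a ≤ zero → zero ≤ - a
  nonpositive⇒neg-nonnegative {a} ea≡0 a≤0 =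
    subst₂ _≤_ (trans (neg-inv a) ea≡0) (zero-id (- a)) (≤-+ a zero (- a) a≤0)

  neg-magnitude : ∀ {m} → Magnitude m → - m ≡ m
  neg-magnitude {m} em≡m = begin
    - m           ≡⟨ sym (e-neutral (- m)) ⟩
    - m + e (- m) ≡⟨ cong (- m +_) (trans (neg-e m) em≡m) ⟩
    - m + m       ≡⟨ +-comm (- m) m ⟩
    m + - m       ≡⟨ neg-inv m ⟩
    e m           ≡⟨ em≡m ⟩
    m             ∎

  e·-neg : ∀ y z → e y · - z ≡ e y · z
  e·-neg y z = begin
    e y · - z   ≡⟨ ·-comm (e y) (- z) ⟩
    - z · e y   ≡⟨ sym (neg-· z (e y)) ⟩
    - (z · e y) ≡⟨ cong -_ (·-comm z (e y)) ⟩
    - (e y · z) ≡⟨ neg-magnitude (e·-magnitude y z) ⟩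
    e y · z     ∎

  magnitude-distrib : ∀ {m} → Magnitude m → ∀ y z → m · y + m · z ≡ m · (y + z) + m · y + m · z
  magnitude-distrib {m} em≡m y z =
    subst (λ t → m · y + m · z ≡ m · (y + z) + t · y + t · z) em≡m (distrib m y z)

  e·u-neutral : ∀ x → x ≢ e x → e x · u x ≡ e x
  e·u-neutral x x≢ex = sym (begin
    e x                              ≡⟨ cong e (sym (u-neutral x x≢ex)) ⟩
    e (x · u x)                      ≡⟨ e-· x (u x) ⟩
    e x · u x + e (u x) · x          ≡⟨ cong (λ t → e x · u x + t · x) (e-u x x≢ex) ⟩
    e x · u x + e x · (x ⁻¹) · x     ≡⟨ cong (e x · u x +_) e·x⁻¹·x ⟩
    e x · u x + e x · u x            ≡⟨ magnitude⇒idempotent (e·-magnitude x (u x)) ⟩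
    e x · u x                        ∎)
    where
    e·x⁻¹·x : e x · (x ⁻¹) · x ≡ e x · u x
    e·x⁻¹·x = trans (·-assoc (e x) (x ⁻¹) x) (cong (e x ·_) (trans (·-comm (x ⁻¹) x) (inv-inv x x≢ex)))

  e[u]·self : ∀ x → x ≢ e x → e (u x) · x ≡ e x
  e[u]·self x x≢ex = begin
    e (u x) · x          ≡⟨ cong (_· x) (e-u x x≢ex) ⟩
    e x · (x ⁻¹) · x     ≡⟨ ·-assoc (e x) (x ⁻¹) x ⟩
    e x · ((x ⁻¹) · x)   ≡⟨ cong (e x ·_) (trans (·-comm (x ⁻¹) x) (inv-inv x x≢ex)) ⟩
    e x · u x            ≡⟨ e·u-neutral x x≢ex ⟩
    e x                  ∎

  e·inverse-transfer : ∀ {x a} → x ≢ e x → a ≢ e a → e (u x) · a ≡ e x →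
                       e x · (a ⁻¹) ≡ e x · (x ⁻¹)
  e·inverse-transfer {x} {a} x≢ex a≢ea Fa≡ex = begin
    e x · (a ⁻¹)             ≡⟨ cong (_· (a ⁻¹)) (sym Fa≡ex) ⟩
    e (u x) · a · (a ⁻¹)     ≡⟨ ·-assoc (e (u x)) a (a ⁻¹) ⟩
    e (u x) · (a · (a ⁻¹))   ≡⟨ cong (e (u x) ·_) (inv-inv a a≢ea) ⟩
    e (u x) · u a            ≡⟨ cong (_· u a) (e-u x x≢ex) ⟩
    e x · (x ⁻¹) · u a       ≡⟨ ·-assoc (e x) (x ⁻¹) (u a) ⟩
    e x · ((x ⁻¹) · u a)     ≡⟨ cong (e x ·_) (·-comm (x ⁻¹) (u a)) ⟩
    e x · (u a · (x ⁻¹))     ≡⟨ sym (·-assoc (e x) (u a) (x ⁻¹)) ⟩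
    e x · u a · (x ⁻¹)       ≡⟨ cong (_· (x ⁻¹)) ex·ua≡ex ⟩
    e x · (x ⁻¹)             ∎
    where
    ex·ua≡ex : e x · u a ≡ e x
    ex·ua≡ex = begin
      e x · u a               ≡⟨ cong (_· u a) (sym Fa≡ex) ⟩
      e (u x) · a · u a       ≡⟨ ·-assoc (e (u x)) a (u a) ⟩
      e (u x) · (a · u a)     ≡⟨ cong (e (u x) ·_) (u-neutral a a≢ea) ⟩
      e (u x) · a             ≡⟨ Fa≡ex ⟩
      e x                     ∎

  module Decomposition {x a : Carrier} (x≢ex : x ≢ e x) (x≡a+ex : x ≡ a + e x) (ea≡0 : e a ≡ zero) where

    a+-a≡0 : a + - a ≡ zero
    a+-a≡0 = trans (neg-inv a) ea≡0

    a≢ea : a ≢ e a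
    a≢ea a≡ea = x≢ex (trans x≡a+ex (trans (cong (_+ e x) (trans a≡ea ea≡0)) (zero-id (e x))))

    a≰e : zero ≤ a → ¬ a ≤ e x
    a≰e 0≤a a≤ex = x≢ex (trans x≡a+ex (absorbed-by-magnitude (e-magnitude x) 0≤a a≤ex))

    -a≰e : a ≤ zero → ¬ - a ≤ e x
    -a≰e a≤0 -a≤ex = x≢ex (begin
      x                 ≡⟨ x≡a+ex ⟩
      a + e x           ≡⟨ cong (a +_) (sym (absorbed-by-magnitude (e-magnitude x)
                                               (nonpositive⇒neg-nonnegative ea≡0 a≤0) -a≤ex)) ⟩
      a + (- a + e x)   ≡⟨ sym (+-assoc a (- a) (e x)) ⟩
      (a + - a) + e x   ≡⟨ cong (_+ e x) a+-a≡0 ⟩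
      zero + e x        ≡⟨ zero-id (e x) ⟩
      e x               ∎)

    e<∣a∣ : e x <∣ a ∣
    e<∣a∣ = (λ ea≤a → ≰⇒> (a≰e (subst (_≤ a) ea≡0 ea≤a)))
          , (λ a<ea → ≰⇒> (-a≰e (subst (a ≤_) ea≡0 (proj₁ a<ea))))

    neg-decomposition : - x ≡ e x + - a
    neg-decomposition = begin
      - x                ≡⟨ sym (e-neutral (- x)) ⟩
      - x + e (- x)      ≡⟨ cong (- x +_) (neg-e x) ⟩
      - x + e x          ≡⟨ cong (- x +_) (sym x+-a≡ex) ⟩
      - x + (x + - a)    ≡⟨ sym (+-assoc (- x) x (- a)) ⟩
      (- x + x) + - a    ≡⟨ cong (_+ - a) (trans (+-comm (- x) x) (neg-inv x)) ⟩
      e x + - a          ∎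
      where
      x+-a≡ex : x + - a ≡ e x
      x+-a≡ex = begin
        x + - a             ≡⟨ cong (_+ - a) (trans x≡a+ex (+-comm a (e x))) ⟩
        (e x + a) + - a     ≡⟨ +-assoc (e x) a (- a) ⟩
        e x + (a + - a)     ≡⟨ cong (e x +_) a+-a≡0 ⟩
        e x + zero          ≡⟨ +-comm (e x) zero ⟩
        zero + e x          ≡⟨ zero-id (e x) ⟩
        e x                 ∎

    e[u]·a-squeeze : ∀ b y → e b ≤ b → e x ≤ b → b ≤ y →
                     e (u x) · b ≡ e (u x) · a → e (u x) · y ≡ e x →
                     e (u x) · a ≤ e x × e (u x) · e x ≤ e (u x) · a
    e[u]·a-squeeze b y eb≤b ex≤b b≤y Fb≡Fa Fy≡ex =
        subst₂ _≤_ Fb≡Fa Fy≡ex (≤-e· (u x) b y eb≤b b≤y)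
      , subst (e (u x) · e x ≤_) Fb≡Fa (≤-e· (u x) (e x) b (reflexive (e-magnitude x)) ex≤b)

    e[u]·a-bounds : e (u x) · a ≤ e x × e (u x) · e x ≤ e (u x) · a
    e[u]·a-bounds with total zero a
    ... | inj₁ 0≤a = e[u]·a-squeeze a x
      (subst (_≤ a) (sym ea≡0) 0≤a)
      (proj₁ (≰⇒> (a≰e 0≤a)))
      (subst₂ _≤_ (zero-id a) (trans (+-comm (e x) a) (sym x≡a+ex)) (≤-+ zero (e x) a (zero≤e x)))
      refl
      (e[u]·self x x≢ex)
    ... | inj₂ a≤0 = e[u]·a-squeeze (- a) (- x)
      (subst (_≤ - a) (sym (trans (neg-e a) ea≡0)) (nonpositive⇒neg-nonnegative ea≡0 a≤0))
      (proj₁ (≰⇒> (-a≰e a≤0)))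
      (subst₂ _≤_ (zero-id (- a)) (sym neg-decomposition) (≤-+ zero (e x) (- a) (zero≤e x)))
      (e·-neg (u x) a)
      (trans (e·-neg (u x) x) (e[u]·self x x≢ex))

    e[u]·a≡e : e (u x) · a ≡ e x
    e[u]·a≡e = antisym Fa≤ex (absorbs⇒≤ (e·-magnitude (u x) a) (sym Fa≡ex+Fa))
      where
      F : Carrier
      F = e (u x)
      Fa≤ex : F · a ≤ e x
      Fa≤ex = proj₁ e[u]·a-bounds
      Fa+Fex≡Fa : F · a + F · e x ≡ F · a
      Fa+Fex≡Fa = trans (+-comm (F · a) (F · e x))
        (≤⇒absorbs (e·-magnitude (u x) (e x)) (e·-magnitude (u x) a) (proj₂ e[u]·a-bounds))
      Fa≡ex+Fa : F · a ≡ e x + F · a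
      Fa≡ex+Fa = begin
        F · a                             ≡⟨ sym Fa+Fex≡Fa ⟩
        F · a + F · e x                   ≡⟨ magnitude-distrib (e-magnitude (u x)) a (e x) ⟩
        F · (a + e x) + F · a + F · e x   ≡⟨ cong (λ t → F · t + F · a + F · e x) (sym x≡a+ex) ⟩
        F · x + F · a + F · e x           ≡⟨ cong (λ t → t + F · a + F · e x) (e[u]·self x x≢ex) ⟩
        e x + F · a + F · e x             ≡⟨ +-assoc (e x) (F · a) (F · e x) ⟩
        e x + (F · a + F · e x)           ≡⟨ cong (e x +_) Fa+Fex≡Fa ⟩
        e x + F · a                       ∎

proposition4p11 : ∀ {c ℓ} (S : Solid c ℓ) → let open Solid S in
    ∀ (x a : Carrier) → x ≢ e x → x ≡ a + e x → e a ≡ zero →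
    (e x <∣ a ∣) × (e x · (a ⁻¹) ≡ e x · (x ⁻¹) × e x · (x ⁻¹) ≡ e (u x))
proposition4p11 S x a x≢ex x≡a+ex ea≡0 =
  e<∣a∣ , e·inverse-transfer x≢ex a≢ea e[u]·a≡e , sym (Solid.e-u S x x≢ex)
  where
  open SolidProperties S
  open Decomposition x≢ex x≡a+ex ea≡0
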